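{- Let $\mathbb{F}_q$ be a finite field, $P,Q\in\mathbb{F}_q[X]\setminus\{0\}$ coprime with $\deg P>\deg Q$, $\mathcal{D}=\{s\in\mathbb{F}_q[X]:\deg s<\deg P\}$, and let $T(P/Q)$ be the expansion graph. Then the only directed cycle of $T(P/Q)$ is a self-loop at the vertex $0$, and every vertex of $T(P/Q)$ has exactly $q^{\deg P-\deg Q}$ outgoing edges.
   Context: The expansion graph $T(P/Q)$ is the edge-labelled directed graph with vertex set $\mathbb{F}_q[X]$ in which there is an edge from $v$ to $w$ with label $s\in\mathcal{D}$ whenever $w=(Pv+s)/Q\in\mathbb{F}_q[X]$. -}

module Defs where

open import Level using (0ℓ)
open import Data.Nat as ℕ using (ℕ; zero; suc; _≤_; _<_; _∸_; _^_)
open import Data.Nat.DivMod using (_%_; m%n<n)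
open import Data.Fin using (Fin; toℕ; fromℕ<)
open import Data.List using (List; []; _∷_)
open import Data.Product using (Σ; ∃; _×_; _,_)
open import Relation.Binary.PropositionalEquality using (_≡_)
open import Relation.Nullary using (¬_)
open import Function.Bundles using (_↔_)
open import Algebra.Core using (Op₁; Op₂)
open import Algebra.Structures using (IsCommutativeRing)

record FiniteField : Set₁ where
  infixl 7 _*_
  infixl 6 _+_
  field
    F      : Set
    _+_    : Op₂ F
    _*_    : Op₂ F
    -_     : Op₁ F
    0#     : F
    1#     : F
    isCommutativeRing : IsCommutativeRing _≡_ _+_ _*_ -_ 0# 1#
    0≢1    : ¬ (0# ≡ 1#)
    inverse : ∀ x → ¬ (x ≡ 0#) → ∃ λ y → x * y ≡ 1#
    q      : ℕ
    enum   : Fin q ↔ F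

-- Polynomials in F_q[X], represented by coefficient lists (constant term
-- first).

module Polynomials (𝔽 : FiniteField) where
  open FiniteField 𝔽 renaming (_+_ to _+F_; _*_ to _*F_)

  Poly : Set
  Poly = List F

  coeff : Poly → ℕ → F
  coeff []       _       = 0#
  coeff (a ∷ p)  zero    = a
  coeff (a ∷ p)  (suc n) = coeff p n

  infix 4 _≈_
  _≈_ : Poly → Poly → Set
  p ≈ r = ∀ n → coeff p n ≡ coeff r n

  0p : Poly
  0p = []

  1p : Poly
  1p = 1# ∷ []

  infixl 6 _⊕_
  _⊕_ : Poly → Poly → Poly
  []      ⊕ r       = r
  (a ∷ p) ⊕ []      = a ∷ p
  (a ∷ p) ⊕ (b ∷ r) = (a +F b) ∷ (p ⊕ r)

  scale : F → Poly → Poly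
  scale a []      = []
  scale a (b ∷ r) = (a *F b) ∷ scale a r

  infixl 7 _⊛_
  _⊛_ : Poly → Poly → Poly
  []      ⊛ r = []
  (a ∷ p) ⊛ r = scale a r ⊕ (0# ∷ (p ⊛ r))

  -- deg p < n  (also true for p = 0, whose degree is -∞)
  DegLt : Poly → ℕ → Set
  DegLt p n = ∀ m → n ≤ m → coeff p m ≡ 0#

  HasDeg : Poly → ℕ → Set
  HasDeg p d = ¬ (coeff p d ≡ 0#) × DegLt p (suc d)

  infix 4 _∣_
  _∣_ : Poly → Poly → Set
  d ∣ p = ∃ λ c → d ⊛ c ≈ p

  IsUnit : Poly → Set
  IsUnit u = ∃ λ c → u ⊛ c ≈ 1p

  Coprime : Poly → Poly → Set
  Coprime P Q = ∀ d → d ∣ P → d ∣ Q → IsUnit d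

  -- The expansion graph T(P/Q), where deg P = dP.  Digit set
  -- D = { s : deg s < deg P }.  Edge v s w : there is an edge from v to w
  -- with label s, i.e. s ∈ D and w = (P v + s)/Q ∈ F_q[X].

  Digit : ℕ → Poly → Set
  Digit dP s = DegLt s dP

  Edge : (P Q : Poly) (dP : ℕ) → Poly → Poly → Poly → Set
  Edge P Q dP v s w = Digit dP s × (P ⊛ v ⊕ s ≈ Q ⊛ w)

  next : ∀ {k} → Fin (suc k) → Fin (suc k)
  next {k} i = fromℕ< (m%n<n (suc (toℕ i)) (suc k))

  record Cycle (P Q : Poly) (dP : ℕ) : Set where
    field
      k        : ℕ
      vertex   : Fin (suc k) → Poly
      label    : Fin (suc k) → Poly
      edge     : ∀ i → Edge P Q dP (vertex i) (label i) (vertex (next i))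
      distinct : ∀ i j → vertex i ≈ vertex j → i ≡ j

  -- v has exactly N outgoing edges: the outgoing edges are enumerated
  -- without repetition by Fin N (edges out of v are distinguished by their
  -- labels, since distinct edges with the same label have the same target).
  OutDegree : (P Q : Poly) (dP : ℕ) → Poly → ℕ → Set
  OutDegree P Q dP v N =
    Σ (Fin N → Poly) λ lab →
      Σ (Fin N → Poly) λ tgt →
        (∀ i → Edge P Q dP v (lab i) (tgt i))
      × (∀ i j → lab i ≈ lab j → i ≡ j)
      × (∀ s w → Edge P Q dP v s w → ∃ λ i → lab i ≈ s × tgt i ≈ w)

module Submission where

-- Both halves of the theorem are degree computations.
--
-- If v ≠ 0 has degree d and there is an edge v → w labelled s,
-- then Q·w = P·v + s has degree deg P + d (because deg s < deg P), so w has
-- degree d + deg P - deg Q > d.  Along a cycle, a vertex of maximal "size"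
-- (0 for the zero polynomial, 1 + degree otherwise) therefore has to be 0,
-- hence every vertex is 0; distinctness of the vertices forces the cycle
-- to be a single loop at 0, whose label is then 0 as well.
--
-- Divide P·v = Q·u + r with deg r < deg Q.  The out-edges of
-- v correspond exactly to the polynomials t with deg t < n = deg P - deg Q:
-- t gives the edge with label Q·t - r and target u + t.  There are q^n such
-- t, listed by an explicit enumeration Fin (q ^ n) → F[X].

open import Defs
open import Data.Nat using (ℕ; _<_; _∸_; _^_)
open import Data.Fin using (zero)
open import Data.Product using (_×_; ∃)
open import Relation.Binary.PropositionalEquality using (_≡_)

open import Level using (0ℓ)
import Data.Nat as Nat
open Nat using (zero; suc; z≤n; s≤s; _≤_; _≤?_)
import Data.Nat.Properties as ℕₚ
open import Data.Fin as Fin using (Fin; toℕ; fromℕ; remQuot; combine)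
import Data.Fin.Properties as Finₚ
open import Data.List using ([]; _∷_)
open import Data.Product using (_,_; proj₁; proj₂; uncurry)
open import Data.Sum using (_⊎_; inj₁; inj₂)
open import Data.Empty using (⊥-elim)
open import Relation.Nullary using (¬_; Dec; yes; no)
open import Relation.Nullary.Decidable using (via-injection)
open import Relation.Binary.PropositionalEquality
  using (refl; sym; trans; cong; cong₂; subst; subst₂; module ≡-Reasoning)
open import Relation.Binary.Definitions using (tri<; tri≈; tri>)
open import Function.Base using (case_of_)
open import Function.Bundles using (Inverse)
open import Function.Properties.Inverse using (↔-sym; ↔⇒↣)
open import Algebra.Bundles using (CommutativeRing)

module Theory (𝔽 : FiniteField) where
  open FiniteField 𝔽
  open Polynomials 𝔽
  open ≡-Reasoning

  F-ring : CommutativeRing 0ℓ 0ℓ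
  F-ring = record { isCommutativeRing = isCommutativeRing }

  open CommutativeRing F-ring
    using ( *-comm; *-identityˡ; *-identityʳ; +-identityˡ; +-identityʳ
          ; zeroˡ; zeroʳ; -‿inverseʳ; ring; +-group; +-abelianGroup
          ; commutativeSemiring )
  open import Algebra.Properties.Ring ring using (-1*x≈-x)
  open import Algebra.Properties.Group +-group using (∙-cancelʳ; x∙y⁻¹≈ε⇒x≈y)
  open import Algebra.Properties.AbelianGroup +-abelianGroup using (xyx⁻¹≈y)
  -- semiring normalisation; negatives - x are treated as atoms and
  -- cancelled by hand with cancel-pair
  open import Algebra.Solver.Ring.NaturalCoefficients.Default commutativeSemiring

  cancel-pair : ∀ a x → a + (x + - x) ≡ a
  cancel-pair a x = trans (cong (a +_) (-‿inverseʳ x)) (+-identityʳ a)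

  no-zero-divisors : ∀ x y → x * y ≡ 0# → ¬ (x ≡ 0#) → y ≡ 0#
  no-zero-divisors x y xy≡0 x≢0 with inverse x x≢0
  ... | x⁻¹ , xx⁻¹≡1 = begin
    y              ≡⟨ sym (*-identityˡ y) ⟩
    1# * y         ≡⟨ cong (_* y) (sym xx⁻¹≡1) ⟩
    (x * x⁻¹) * y  ≡⟨ solve 3 (λ x x⁻¹ y → (x :* x⁻¹) :* y := x⁻¹ :* (x :* y)) refl x x⁻¹ y ⟩
    x⁻¹ * (x * y)  ≡⟨ cong (x⁻¹ *_) xy≡0 ⟩
    x⁻¹ * 0#       ≡⟨ zeroʳ x⁻¹ ⟩
    0#             ∎

  _≟F_ : (x y : F) → Dec (x ≡ y)
  _≟F_ = via-injection (↔⇒↣ (↔-sym enum)) Fin._≟_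

  coeff-⊕ : ∀ p r n → coeff (p ⊕ r) n ≡ coeff p n + coeff r n
  coeff-⊕ []      r       n       = sym (+-identityˡ _)
  coeff-⊕ (a ∷ p) []      n       = sym (+-identityʳ _)
  coeff-⊕ (a ∷ p) (b ∷ r) zero    = refl
  coeff-⊕ (a ∷ p) (b ∷ r) (suc n) = coeff-⊕ p r n

  coeff-scale : ∀ a r n → coeff (scale a r) n ≡ a * coeff r n
  coeff-scale a []      n       = sym (zeroʳ a)
  coeff-scale a (b ∷ r) zero    = refl
  coeff-scale a (b ∷ r) (suc n) = coeff-scale a r n

  infixl 6 _⊖_
  _⊖_ : Poly → Poly → Poly
  p ⊖ r = p ⊕ scale (- 1#) r

  coeff-⊖ : ∀ p r n → coeff (p ⊖ r) n ≡ coeff p n + - coeff r n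
  coeff-⊖ p r n = trans (coeff-⊕ p _ n)
    (cong (coeff p n +_) (trans (coeff-scale (- 1#) r n) (-1*x≈-x _)))

  -- (a ∷ p) ⊛ r = a·r + X·(p ⊛ r), where X·z is written 0# ∷ z
  coeff-⊛ : ∀ a p r n → coeff ((a ∷ p) ⊛ r) n ≡ a * coeff r n + coeff (0# ∷ p ⊛ r) n
  coeff-⊛ a p r n = trans (coeff-⊕ (scale a r) _ n) (cong (_+ _) (coeff-scale a r n))

  X·-zero : ∀ p → p ≈ 0p → (0# ∷ p) ≈ 0p
  X·-zero p p≈0 zero    = refl
  X·-zero p p≈0 (suc n) = p≈0 n

  ⊛-zeroʳ : ∀ p r → r ≈ 0p → p ⊛ r ≈ 0p
  ⊛-zeroʳ []      r r≈0 n = refl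
  ⊛-zeroʳ (a ∷ p) r r≈0 n = begin
    coeff ((a ∷ p) ⊛ r) n                 ≡⟨ coeff-⊛ a p r n ⟩
    a * coeff r n + coeff (0# ∷ p ⊛ r) n  ≡⟨ cong₂ _+_ (trans (cong (a *_) (r≈0 n)) (zeroʳ a))
                                                        (X·-zero _ (⊛-zeroʳ p r r≈0) n) ⟩
    0# + 0#                               ≡⟨ +-identityʳ 0# ⟩
    0#                                    ∎

  ⊛-zeroˡ : ∀ p r → p ≈ 0p → p ⊛ r ≈ 0p
  ⊛-zeroˡ []      r p≈0 n = refl
  ⊛-zeroˡ (a ∷ p) r p≈0 n = begin
    coeff ((a ∷ p) ⊛ r) n                 ≡⟨ coeff-⊛ a p r n ⟩
    a * coeff r n + coeff (0# ∷ p ⊛ r) n  ≡⟨ cong₂ _+_ (trans (cong (_* coeff r n) (p≈0 zero)) (zeroˡ _))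
                                                        (X·-zero _ (⊛-zeroˡ p r (λ m → p≈0 (suc m))) n) ⟩
    0# + 0#                               ≡⟨ +-identityʳ 0# ⟩
    0#                                    ∎

  ⊛-congʳ : ∀ p r r′ → r ≈ r′ → p ⊛ r ≈ p ⊛ r′
  ⊛-congʳ []      r r′ r≈r′ n = refl
  ⊛-congʳ (a ∷ p) r r′ r≈r′ n = begin
    coeff ((a ∷ p) ⊛ r) n                  ≡⟨ coeff-⊛ a p r n ⟩
    a * coeff r n + coeff (0# ∷ p ⊛ r) n   ≡⟨ cong₂ _+_ (cong (a *_) (r≈r′ n)) (shifted n) ⟩
    a * coeff r′ n + coeff (0# ∷ p ⊛ r′) n ≡⟨ sym (coeff-⊛ a p r′ n) ⟩
    coeff ((a ∷ p) ⊛ r′) n                 ∎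
    where
      shifted : ∀ n → coeff (0# ∷ p ⊛ r) n ≡ coeff (0# ∷ p ⊛ r′) n
      shifted zero    = refl
      shifted (suc n) = ⊛-congʳ p r r′ r≈r′ n

  ⊛-distribʳ : ∀ p x y n → coeff (p ⊛ (x ⊕ y)) n ≡ coeff (p ⊛ x) n + coeff (p ⊛ y) n
  ⊛-distribʳ []      x y n = sym (+-identityʳ 0#)
  ⊛-distribʳ (a ∷ p) x y n = begin
    coeff ((a ∷ p) ⊛ (x ⊕ y)) n
      ≡⟨ coeff-⊛ a p (x ⊕ y) n ⟩
    a * coeff (x ⊕ y) n + coeff (0# ∷ p ⊛ (x ⊕ y)) n
      ≡⟨ cong₂ _+_ (cong (a *_) (coeff-⊕ x y n)) (shifted n) ⟩
    a * (X + Y) + (U + V)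
      ≡⟨ solve 5 (λ a X Y U V → a :* (X :+ Y) :+ (U :+ V) := (a :* X :+ U) :+ (a :* Y :+ V)) refl a X Y U V ⟩
    (a * X + U) + (a * Y + V)
      ≡⟨ sym (cong₂ _+_ (coeff-⊛ a p x n) (coeff-⊛ a p y n)) ⟩
    coeff ((a ∷ p) ⊛ x) n + coeff ((a ∷ p) ⊛ y) n
      ∎
    where
      X Y U V : F
      X = coeff x n
      Y = coeff y n
      U = coeff (0# ∷ p ⊛ x) n
      V = coeff (0# ∷ p ⊛ y) n
      shifted : ∀ n → coeff (0# ∷ p ⊛ (x ⊕ y)) n ≡ coeff (0# ∷ p ⊛ x) n + coeff (0# ∷ p ⊛ y) n
      shifted zero    = sym (+-identityʳ 0#)
      shifted (suc n) = ⊛-distribʳ p x y n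

  ⊛-scale : ∀ p c r n → coeff (p ⊛ scale c r) n ≡ c * coeff (p ⊛ r) n
  ⊛-scale []      c r n = sym (zeroʳ c)
  ⊛-scale (a ∷ p) c r n = begin
    coeff ((a ∷ p) ⊛ scale c r) n
      ≡⟨ coeff-⊛ a p (scale c r) n ⟩
    a * coeff (scale c r) n + coeff (0# ∷ p ⊛ scale c r) n
      ≡⟨ cong₂ _+_ (cong (a *_) (coeff-scale c r n)) (shifted n) ⟩
    a * (c * R) + c * U
      ≡⟨ solve 4 (λ a c R U → a :* (c :* R) :+ c :* U := c :* (a :* R :+ U)) refl a c R U ⟩
    c * (a * R + U)
      ≡⟨ cong (c *_) (sym (coeff-⊛ a p r n)) ⟩
    c * coeff ((a ∷ p) ⊛ r) n
      ∎
    where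
      R U : F
      R = coeff r n
      U = coeff (0# ∷ p ⊛ r) n
      shifted : ∀ n → coeff (0# ∷ p ⊛ scale c r) n ≡ c * coeff (0# ∷ p ⊛ r) n
      shifted zero    = sym (zeroʳ c)
      shifted (suc n) = ⊛-scale p c r n

  ⊛-⊖ : ∀ p x y n → coeff (p ⊛ (x ⊖ y)) n ≡ coeff (p ⊛ x) n + - coeff (p ⊛ y) n
  ⊛-⊖ p x y n = trans (⊛-distribʳ p x _ n)
    (cong (coeff (p ⊛ x) n +_) (trans (⊛-scale p (- 1#) y n) (-1*x≈-x _)))

  coeff-⊛-∷ʳ : ∀ p k r n → coeff (p ⊛ (k ∷ r)) n ≡ k * coeff p n + coeff (0# ∷ p ⊛ r) n
  coeff-⊛-∷ʳ []      k r n       =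
    sym (trans (cong₂ _+_ (zeroʳ k) (X·-zero [] (λ _ → refl) n)) (+-identityʳ 0#))
  coeff-⊛-∷ʳ (b ∷ p) k r zero    = trans (coeff-⊛ b p (k ∷ r) zero)
    (cong (_+ 0#) (*-comm b k))
  coeff-⊛-∷ʳ (b ∷ p) k r (suc n) = begin
    coeff ((b ∷ p) ⊛ (k ∷ r)) (suc n)          ≡⟨ coeff-⊛ b p (k ∷ r) (suc n) ⟩
    b * coeff r n + coeff (p ⊛ (k ∷ r)) n      ≡⟨ cong (b * coeff r n +_) (coeff-⊛-∷ʳ p k r n) ⟩
    b * coeff r n + (k * coeff p n + U)
      ≡⟨ solve 5 (λ b R k P U → b :* R :+ (k :* P :+ U) := k :* P :+ (b :* R :+ U)) refl b (coeff r n) k (coeff p n) U ⟩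
    k * coeff p n + (b * coeff r n + U)        ≡⟨ cong (k * coeff p n +_) (sym (coeff-⊛ b p r n)) ⟩
    k * coeff p n + coeff ((b ∷ p) ⊛ r) n      ∎
    where
      U : F
      U = coeff (0# ∷ p ⊛ r) n

  DegLt-⊛ : ∀ p a r b → DegLt p (suc a) → DegLt r b → DegLt (p ⊛ r) (a Nat.+ b)
  DegLt-⊛ []      a       r b p<1+a r<b m _ = refl
  DegLt-⊛ (c ∷ p) zero    r b p<1   r<b m b≤m = begin
    coeff ((c ∷ p) ⊛ r) m                  ≡⟨ coeff-⊛ c p r m ⟩
    c * coeff r m + coeff (0# ∷ p ⊛ r) m   ≡⟨ cong₂ _+_ (trans (cong (c *_) (r<b m b≤m)) (zeroʳ c))
                                              (X·-zero _ (⊛-zeroˡ p r (λ n → p<1 (suc n) (s≤s z≤n))) m) ⟩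
    0# + 0#                                ≡⟨ +-identityʳ 0# ⟩
    0#                                     ∎
  DegLt-⊛ (c ∷ p) (suc a) r b p<2+a r<b (suc m) (s≤s a+b≤m) = begin
    coeff ((c ∷ p) ⊛ r) (suc m)            ≡⟨ coeff-⊛ c p r (suc m) ⟩
    c * coeff r (suc m) + coeff (p ⊛ r) m  ≡⟨ cong₂ _+_ (trans (cong (c *_) (r<b (suc m) b≤1+m)) (zeroʳ c))
                                              (DegLt-⊛ p a r b (λ n a<n → p<2+a (suc n) (s≤s a<n)) r<b m a+b≤m) ⟩
    0# + 0#                                ≡⟨ +-identityʳ 0# ⟩
    0#                                     ∎
    where
      b≤1+m : b ≤ suc m
      b≤1+m = ℕₚ.m≤n⇒m≤1+n (ℕₚ.≤-trans (ℕₚ.m≤n+m b a) a+b≤m)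

  coeff-⊛-top : ∀ p a r b → DegLt p (suc a) → DegLt r (suc b) →
                coeff (p ⊛ r) (a Nat.+ b) ≡ coeff p a * coeff r b
  coeff-⊛-top []      a       r b p≤a r≤b = sym (zeroˡ _)
  coeff-⊛-top (c ∷ p) zero    r b p≤0 r≤b = begin
    coeff ((c ∷ p) ⊛ r) b                  ≡⟨ coeff-⊛ c p r b ⟩
    c * coeff r b + coeff (0# ∷ p ⊛ r) b   ≡⟨ cong (c * coeff r b +_)
                                                (X·-zero _ (⊛-zeroˡ p r (λ n → p≤0 (suc n) (s≤s z≤n))) b) ⟩
    c * coeff r b + 0#                     ≡⟨ +-identityʳ _ ⟩
    c * coeff r b                          ∎
  coeff-⊛-top (c ∷ p) (suc a) r b p≤1+a r≤b = begin
    coeff ((c ∷ p) ⊛ r) (suc a Nat.+ b)                ≡⟨ coeff-⊛ c p r (suc a Nat.+ b) ⟩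
    c * coeff r (suc a Nat.+ b) + coeff (p ⊛ r) (a Nat.+ b)
      ≡⟨ cong₂ _+_ (trans (cong (c *_) (r≤b _ (s≤s (ℕₚ.m≤n+m b a)))) (zeroʳ c))
                   (coeff-⊛-top p a r b (λ n a<n → p≤1+a (suc n) (s≤s a<n)) r≤b) ⟩
    0# + coeff p a * coeff r b                       ≡⟨ +-identityˡ _ ⟩
    coeff p a * coeff r b                            ∎

  HasDeg-⊛ : ∀ p a r b → HasDeg p a → HasDeg r b → HasDeg (p ⊛ r) (a Nat.+ b)
  HasDeg-⊛ p a r b (pa≢0 , p≤a) (rb≢0 , r≤b) = top≢0 , bound
    where
      top≢0 : ¬ (coeff (p ⊛ r) (a Nat.+ b) ≡ 0#)
      top≢0 top≡0 = rb≢0 (no-zero-divisors _ _ (trans (sym (coeff-⊛-top p a r b p≤a r≤b)) top≡0) pa≢0)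
      bound : DegLt (p ⊛ r) (suc (a Nat.+ b))
      bound = subst (DegLt (p ⊛ r)) (ℕₚ.+-suc a b) (DegLt-⊛ p a r (suc b) p≤a r≤b)

  zero-or-degree : ∀ p → (p ≈ 0p) ⊎ (∃ λ d → HasDeg p d)
  zero-or-degree []      = inj₁ (λ n → refl)
  zero-or-degree (a ∷ p) with zero-or-degree p
  ... | inj₂ (d , pd≢0 , p≤d) = inj₂ (suc d , pd≢0 , λ { (suc m) (s≤s d<m) → p≤d m d<m })
  ... | inj₁ p≈0 with a ≟F 0#
  ...   | yes a≡0 = inj₁ (λ { zero → a≡0 ; (suc n) → p≈0 n })
  ...   | no a≢0  = inj₂ (zero , a≢0 , λ { (suc m) _ → p≈0 m })

  HasDeg-unique : ∀ p a b → HasDeg p a → HasDeg p b → a ≡ b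
  HasDeg-unique p a b (pa≢0 , p≤a) (pb≢0 , p≤b) with ℕₚ.<-cmp a b
  ... | tri< a<b _ _ = ⊥-elim (pb≢0 (p≤a b a<b))
  ... | tri≈ _ a≡b _ = a≡b
  ... | tri> _ _ b<a = ⊥-elim (pa≢0 (p≤b a b<a))

  HasDeg-≈ : ∀ p r d → p ≈ r → HasDeg p d → HasDeg r d
  HasDeg-≈ p r d p≈r (pd≢0 , p≤d) =
    (λ rd≡0 → pd≢0 (trans (p≈r d) rd≡0)) , (λ m d<m → trans (sym (p≈r m)) (p≤d m d<m))

  HasDeg-⊕-small : ∀ p s D k → HasDeg p D → DegLt s k → k ≤ D → HasDeg (p ⊕ s) D
  HasDeg-⊕-small p s D k (pD≢0 , p≤D) s<k k≤D = top≢0 , bound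
    where
      top≢0 : ¬ (coeff (p ⊕ s) D ≡ 0#)
      top≢0 sum≡0 = pD≢0 (begin
        coeff p D              ≡⟨ sym (+-identityʳ _) ⟩
        coeff p D + 0#         ≡⟨ cong (coeff p D +_) (sym (s<k D k≤D)) ⟩
        coeff p D + coeff s D  ≡⟨ sym (coeff-⊕ p s D) ⟩
        coeff (p ⊕ s) D        ≡⟨ sum≡0 ⟩
        0#                     ∎)
      bound : DegLt (p ⊕ s) (suc D)
      bound m D<m = trans (coeff-⊕ p s m)
        (trans (cong₂ _+_ (p≤D m D<m) (s<k m (ℕₚ.≤-trans k≤D (ℕₚ.<⇒≤ D<m)))) (+-identityʳ 0#))

  DegLt-cancelˡ : ∀ Q dQ → HasDeg Q dQ → ∀ t n → DegLt (Q ⊛ t) (dQ Nat.+ n) → DegLt t n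
  DegLt-cancelˡ Q dQ hQ t n Qt<dQ+n with zero-or-degree t
  ... | inj₁ t≈0 = λ m _ → t≈0 m
  ... | inj₂ (e , ht) with n ≤? e
  ...   | yes n≤e = ⊥-elim (proj₁ (HasDeg-⊛ Q dQ t e hQ ht) (Qt<dQ+n _ (ℕₚ.+-monoʳ-≤ dQ n≤e)))
  ...   | no n≰e  = λ m n≤m → proj₂ ht m (ℕₚ.≤-trans (ℕₚ.≰⇒> n≰e) n≤m)

  ⊛-cancelˡ : ∀ Q dQ → HasDeg Q dQ → ∀ x y → Q ⊛ x ≈ Q ⊛ y → x ≈ y
  ⊛-cancelˡ Q dQ hQ x y Qx≈Qy n = x∙y⁻¹≈ε⇒x≈y _ _ (trans (sym (coeff-⊖ x y n)) (x-y≈0 n z≤n))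
    where
      Q[x-y]≈0 : ∀ m → coeff (Q ⊛ (x ⊖ y)) m ≡ 0#
      Q[x-y]≈0 m = begin
        coeff (Q ⊛ (x ⊖ y)) m                       ≡⟨ ⊛-⊖ Q x y m ⟩
        coeff (Q ⊛ x) m + - coeff (Q ⊛ y) m         ≡⟨ cong (λ z → z + - coeff (Q ⊛ y) m) (Qx≈Qy m) ⟩
        coeff (Q ⊛ y) m + - coeff (Q ⊛ y) m         ≡⟨ -‿inverseʳ _ ⟩
        0#                                          ∎
      x-y≈0 : DegLt (x ⊖ y) 0
      x-y≈0 = DegLt-cancelˡ Q dQ hQ (x ⊖ y) 0 (λ m _ → Q[x-y]≈0 m)

  -- Division with remainder by a polynomial Q of degree dQ

  module Division (Q : Poly) (dQ : ℕ) (hQ : HasDeg Q dQ) where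

    lead : F
    lead = coeff Q dQ

    lead⁻¹ : F
    lead⁻¹ = proj₁ (inverse lead (proj₁ hQ))

    reduce : ∀ r → DegLt r (suc dQ) → ∃ λ k → DegLt (r ⊖ scale k Q) dQ
    reduce r r≤dQ = k , bound
      where
        c k : F
        c = coeff r dQ
        k = c * lead⁻¹
        kQ≡c : k * lead ≡ c
        kQ≡c = begin
          (c * lead⁻¹) * lead  ≡⟨ solve 3 (λ c i l → (c :* i) :* l := c :* (l :* i)) refl c lead⁻¹ lead ⟩
          c * (lead * lead⁻¹)  ≡⟨ cong (c *_) (proj₂ (inverse lead (proj₁ hQ))) ⟩
          c * 1#               ≡⟨ *-identityʳ c ⟩
          c                    ∎
        bound : DegLt (r ⊖ scale k Q) dQ
        bound m dQ≤m with ℕₚ.m≤n⇒m<n∨m≡n dQ≤m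
        ... | inj₁ dQ<m = begin
          coeff (r ⊖ scale k Q) m          ≡⟨ coeff-⊖ r (scale k Q) m ⟩
          coeff r m + - coeff (scale k Q) m ≡⟨ cong₂ (λ a b → a + - b) (r≤dQ m dQ<m)
                                                 (trans (coeff-scale k Q m) (trans (cong (k *_) (proj₂ hQ m dQ<m)) (zeroʳ k))) ⟩
          0# + - 0#                        ≡⟨ -‿inverseʳ 0# ⟩
          0#                               ∎
        ... | inj₂ refl = begin
          coeff (r ⊖ scale k Q) dQ          ≡⟨ coeff-⊖ r (scale k Q) dQ ⟩
          c + - coeff (scale k Q) dQ        ≡⟨ cong (λ b → c + - b) (trans (coeff-scale k Q dQ) kQ≡c) ⟩
          c + - c                           ≡⟨ -‿inverseʳ c ⟩
          0#                                ∎

    record DivisionOf (A : Poly) : Set where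
      field
        quot       : Poly
        rem        : Poly
        splits     : A ≈ Q ⊛ quot ⊕ rem
        rem-small  : DegLt rem dQ

    -- long division, processing the coefficients of A from the top down
    divide : ∀ A → DivisionOf A
    divide []      = record
      { quot = [] ; rem = []
      ; splits = λ n → sym (trans (coeff-⊕ (Q ⊛ []) [] n)
                       (trans (cong (_+ 0#) (⊛-zeroʳ Q [] (λ _ → refl) n)) (+-identityʳ 0#)))
      ; rem-small = λ _ _ → refl }
    divide (a ∷ A) = record
      { quot = k ∷ u ; rem = r₁ ⊖ scale k Q ; splits = splits′ ; rem-small = proj₂ reduced }
      where
        open DivisionOf (divide A) renaming (quot to u; rem to r; splits to A≈Qu+r)
        r₁ : Poly
        r₁ = a ∷ r
        r₁≤dQ : DegLt r₁ (suc dQ)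
        r₁≤dQ (suc m) (s≤s dQ≤m) = rem-small m dQ≤m
        reduced : ∃ λ k → DegLt (r₁ ⊖ scale k Q) dQ
        reduced = reduce r₁ r₁≤dQ
        k : F
        k = proj₁ reduced
        rearranged : ∀ n →
          coeff (Q ⊛ (k ∷ u) ⊕ (r₁ ⊖ scale k Q)) n ≡ coeff (0# ∷ Q ⊛ u) n + coeff r₁ n
        rearranged n = begin
          coeff (Q ⊛ (k ∷ u) ⊕ (r₁ ⊖ scale k Q)) n
            ≡⟨ coeff-⊕ (Q ⊛ (k ∷ u)) _ n ⟩
          coeff (Q ⊛ (k ∷ u)) n + coeff (r₁ ⊖ scale k Q) n
            ≡⟨ cong₂ _+_ (coeff-⊛-∷ʳ Q k u n)
                         (trans (coeff-⊖ r₁ (scale k Q) n) (cong (λ z → R + - z) (coeff-scale k Q n))) ⟩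
          (kQ + U) + (R + - kQ)
            ≡⟨ solve 4 (λ kQ U R m → (kQ :+ U) :+ (R :+ m) := (U :+ R) :+ (kQ :+ m)) refl kQ U R (- kQ) ⟩
          (U + R) + (kQ + - kQ)
            ≡⟨ cancel-pair (U + R) kQ ⟩
          U + R
            ∎
          where
            kQ U R : F
            kQ = k * coeff Q n
            U = coeff (0# ∷ Q ⊛ u) n
            R = coeff r₁ n
        splits′ : (a ∷ A) ≈ Q ⊛ (k ∷ u) ⊕ (r₁ ⊖ scale k Q)
        splits′ zero    = sym (trans (rearranged zero) (+-identityˡ a))
        splits′ (suc m) = trans (A≈Qu+r m) (trans (coeff-⊕ (Q ⊛ u) r m) (sym (rearranged (suc m))))

  -- The polynomials of degree < n, enumerated by Fin (q ^ n)

  tailP : Poly → Poly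
  tailP []      = []
  tailP (a ∷ p) = p

  coeff-tailP : ∀ p n → coeff (tailP p) n ≡ coeff p (suc n)
  coeff-tailP []      n = refl
  coeff-tailP (a ∷ p) n = refl

  -- the coefficient of X^i in enumPoly n j is digit i of j in base q,
  -- read through the enumeration Fin q ↔ F
  enumPoly : ∀ n → Fin (q ^ n) → Poly
  enumPoly zero    i = []
  enumPoly (suc n) i =
    Inverse.to enum (proj₁ (remQuot {q} (q ^ n) i)) ∷ enumPoly n (proj₂ (remQuot {q} (q ^ n) i))

  enumPoly-deg : ∀ n i → DegLt (enumPoly n i) n
  enumPoly-deg zero    i m       _         = refl
  enumPoly-deg (suc n) i (suc m) (s≤s n≤m) = enumPoly-deg n _ m n≤m

  enumPoly-combine : ∀ n a j → enumPoly (suc n) (combine a j) ≈ (Inverse.to enum a ∷ enumPoly n j)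
  enumPoly-combine n a j m = cong (λ aj → coeff (Inverse.to enum (proj₁ aj) ∷ enumPoly n (proj₂ aj)) m)
                                  (Finₚ.remQuot-combine {q} {q ^ n} a j)

  enumPoly-injective : ∀ n i j → enumPoly n i ≈ enumPoly n j → i ≡ j
  enumPoly-injective zero    zero zero _   = refl
  enumPoly-injective (suc n) i    j    i≈j = begin
    i                                         ≡⟨ sym (Finₚ.combine-remQuot {q} (q ^ n) i) ⟩
    uncurry combine (remQuot {q} (q ^ n) i)   ≡⟨ cong (uncurry combine) (cong₂ _,_ same-digit same-rest) ⟩
    uncurry combine (remQuot {q} (q ^ n) j)   ≡⟨ Finₚ.combine-remQuot {q} (q ^ n) j ⟩
    j                                         ∎
    where
      same-digit : proj₁ (remQuot {q} (q ^ n) i) ≡ proj₁ (remQuot {q} (q ^ n) j)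
      same-digit = trans (sym (Inverse.strictlyInverseʳ enum _))
                     (trans (cong (Inverse.from enum) (i≈j zero)) (Inverse.strictlyInverseʳ enum _))
      same-rest : proj₂ (remQuot {q} (q ^ n) i) ≡ proj₂ (remQuot {q} (q ^ n) j)
      same-rest = enumPoly-injective n _ _ (λ m → i≈j (suc m))

  enumPoly-surjective : ∀ n t → DegLt t n → ∃ λ i → enumPoly n i ≈ t
  enumPoly-surjective zero    t t<0   = zero , λ m → sym (t<0 m z≤n)
  enumPoly-surjective (suc n) t t<1+n with enumPoly-surjective n (tailP t) tail<n
    where tail<n : DegLt (tailP t) n
          tail<n m n≤m = trans (coeff-tailP t m) (t<1+n (suc m) (s≤s n≤m))
  ... | j , j↦tail = combine (Inverse.from enum (coeff t 0)) j , λ m →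
          trans (enumPoly-combine n _ j m) (digits m)
    where
      digits : ∀ m → coeff (Inverse.to enum (Inverse.from enum (coeff t 0)) ∷ enumPoly n j) m ≡ coeff t m
      digits zero    = Inverse.strictlyInverseˡ enum (coeff t 0)
      digits (suc m) = trans (j↦tail m) (coeff-tailP t m)

  size : Poly → ℕ
  size p with zero-or-degree p
  ... | inj₁ _       = 0
  ... | inj₂ (d , _) = suc d

  size-HasDeg : ∀ p d → HasDeg p d → size p ≡ suc d
  size-HasDeg p d hp with zero-or-degree p
  ... | inj₁ p≈0      = ⊥-elim (proj₁ hp (p≈0 d))
  ... | inj₂ (e , he) = cong suc (HasDeg-unique p e d he hp)

  size-zero : ∀ p → p ≈ 0p → size p ≡ 0
  size-zero p p≈0 with zero-or-degree p
  ... | inj₁ _        = refl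
  ... | inj₂ (d , hp) = ⊥-elim (proj₁ hp (p≈0 d))

  size≡0 : ∀ p → size p ≡ 0 → p ≈ 0p
  size≡0 p size-p≡0 with zero-or-degree p | size-p≡0
  ... | inj₁ p≈0 | _  = p≈0
  ... | inj₂ _   | ()

  argmax : ∀ k (g : Fin (suc k) → ℕ) → ∃ λ i → ∀ j → g j ≤ g i
  argmax zero    g = zero , λ { zero → ℕₚ.≤-refl }
  argmax (suc k) g with argmax k (λ j → g (Fin.suc j))
  ... | i , max with g zero ≤? g (Fin.suc i)
  ...   | yes g0≤ = Fin.suc i , λ { zero → g0≤ ; (Fin.suc j) → max j }
  ...   | no g0≰  = zero , λ { zero → ℕₚ.≤-refl
                             ; (Fin.suc j) → ℕₚ.≤-trans (max j) (ℕₚ.<⇒≤ (ℕₚ.≰⇒> g0≰)) }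

  -- The expansion graph T(P/Q) with deg P = dP > dQ = deg Q

  module ExpansionGraph (P Q : Poly) (dP dQ : ℕ) (hP : HasDeg P dP) (hQ : HasDeg Q dQ) (dQ<dP : dQ < dP) where

    -- the out-degree is q^n
    n : ℕ
    n = dP ∸ dQ

    dQ+n≡dP : dQ Nat.+ n ≡ dP
    dQ+n≡dP = ℕₚ.m+[n∸m]≡n (ℕₚ.<⇒≤ dQ<dP)

    target-degree : ∀ v s w d → Edge P Q dP v s w → HasDeg v d → HasDeg (Q ⊛ w) (dP Nat.+ d)
    target-degree v s w d (s<dP , Pv+s≈Qw) hv =
      HasDeg-≈ (P ⊛ v ⊕ s) (Q ⊛ w) (dP Nat.+ d) Pv+s≈Qw
        (HasDeg-⊕-small (P ⊛ v) s (dP Nat.+ d) dP (HasDeg-⊛ P dP v d hP hv) s<dP (ℕₚ.m≤m+n dP d))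

    degree-grows : ∀ v s w d → Edge P Q dP v s w → HasDeg v d → ∃ λ e → HasDeg w e × d < e
    degree-grows v s w d edge hv with zero-or-degree w
    ... | inj₁ w≈0 = ⊥-elim (proj₁ (target-degree v s w d edge hv) (⊛-zeroʳ Q w w≈0 _))
    ... | inj₂ (e , hw) with e ≤? d
    ...   | no e≰d  = e , hw , ℕₚ.≰⇒> e≰d
    ...   | yes e≤d = ⊥-elim (ℕₚ.<-irrefl degrees-agree (ℕₚ.+-mono-<-≤ dQ<dP e≤d))
      where
        degrees-agree : dQ Nat.+ e ≡ dP Nat.+ d
        degrees-agree = HasDeg-unique (Q ⊛ w) _ _ (HasDeg-⊛ Q dQ w e hQ hw) (target-degree v s w d edge hv)

    size-grows : ∀ v s w → Edge P Q dP v s w → size v ≡ 0 ⊎ size v < size w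
    size-grows v s w edge = case zero-or-degree v of λ where
      (inj₁ v≈0)      → inj₁ (size-zero v v≈0)
      (inj₂ (d , hv)) → let (e , hw , d<e) = degree-grows v s w d edge hv in
        inj₂ (subst₂ _<_ (sym (size-HasDeg v d hv)) (sym (size-HasDeg w e hw)) (s≤s d<e))

    zero-edge-label : ∀ v s w → Edge P Q dP v s w → v ≈ 0p → w ≈ 0p → s ≈ 0p
    zero-edge-label v s w (_ , Pv+s≈Qw) v≈0 w≈0 m = begin
      coeff s m                      ≡⟨ sym (+-identityˡ _) ⟩
      0# + coeff s m                 ≡⟨ cong (_+ coeff s m) (sym (⊛-zeroʳ P v v≈0 m)) ⟩
      coeff (P ⊛ v) m + coeff s m    ≡⟨ sym (coeff-⊕ (P ⊛ v) s m) ⟩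
      coeff (P ⊛ v ⊕ s) m            ≡⟨ Pv+s≈Qw m ⟩
      coeff (Q ⊛ w) m                ≡⟨ ⊛-zeroʳ Q w w≈0 m ⟩
      0#                             ∎

    zero-self-loop : ∃ λ s → Edge P Q dP 0p s 0p
    zero-self-loop = 0p , (λ _ _ → refl) , λ m → begin
      coeff (P ⊛ 0p ⊕ 0p) m  ≡⟨ coeff-⊕ (P ⊛ 0p) 0p m ⟩
      coeff (P ⊛ 0p) m + 0#  ≡⟨ +-identityʳ _ ⟩
      coeff (P ⊛ 0p) m       ≡⟨ ⊛-zeroʳ P 0p (λ _ → refl) m ⟩
      0#                     ≡⟨ sym (⊛-zeroʳ Q 0p (λ _ → refl) m) ⟩
      coeff (Q ⊛ 0p) m       ∎

    -- a vertex of maximal size on a cycle is 0, so every vertex is 0, and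
    -- distinctness leaves only the loop at 0
    cycle-is-zero-loop : (c : Cycle P Q dP) →
      Cycle.k c ≡ 0 × Cycle.vertex c zero ≈ 0p × Cycle.label c zero ≈ 0p
    cycle-is-zero-loop c = k≡0 , all-zero zero , zero-edge-label _ _ _ (edge zero) (all-zero zero) (all-zero (next zero))
      where
        open Cycle c
        sizes : Fin (suc k) → ℕ
        sizes i = size (vertex i)
        largest : ∃ λ i → ∀ j → sizes j ≤ sizes i
        largest = argmax k sizes
        i₀ : Fin (suc k)
        i₀ = proj₁ largest
        maximal : ∀ j → sizes j ≤ sizes i₀
        maximal = proj₂ largest
        largest-zero : sizes i₀ ≡ 0
        largest-zero with size-grows _ _ _ (edge i₀)
        ... | inj₁ size≡0 = size≡0
        ... | inj₂ grows  = ⊥-elim (ℕₚ.<⇒≱ grows (maximal (next i₀)))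
        all-zero : ∀ j → vertex j ≈ 0p
        all-zero j = size≡0 (vertex j) (ℕₚ.n≤0⇒n≡0 (subst (sizes j ≤_) largest-zero (maximal j)))
        first≈last : vertex zero ≈ vertex (fromℕ k)
        first≈last m = trans (all-zero zero m) (sym (all-zero (fromℕ k) m))
        k≡0 : k ≡ 0
        k≡0 = begin
          k              ≡⟨ sym (Finₚ.toℕ-fromℕ k) ⟩
          toℕ (fromℕ k)  ≡⟨ cong toℕ (sym (distinct zero (fromℕ k) first≈last)) ⟩
          0              ∎

    -- the out-edges of v, indexed by the offsets t with deg t < n
    module OutEdges (v : Poly) where
      open Division Q dQ hQ
      open DivisionOf (divide (P ⊛ v)) renaming (quot to u; rem to r; splits to Pv≈Qu+r; rem-small to r<dQ)

      edge-label : Poly → Poly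
      edge-label t = Q ⊛ t ⊖ r

      edge-target : Poly → Poly
      edge-target t = u ⊕ t

      offset-edge : ∀ t → DegLt t n → Edge P Q dP v (edge-label t) (edge-target t)
      offset-edge t t<n = digit , equation
        where
          digit : DegLt (edge-label t) dP
          digit m dP≤m = begin
            coeff (Q ⊛ t ⊖ r) m              ≡⟨ coeff-⊖ (Q ⊛ t) r m ⟩
            coeff (Q ⊛ t) m + - coeff r m    ≡⟨ cong₂ (λ a b → a + - b)
                                                  (DegLt-⊛ Q dQ t n (proj₂ hQ) t<n m (subst (_≤ m) (sym dQ+n≡dP) dP≤m))
                                                  (r<dQ m (ℕₚ.≤-trans (ℕₚ.<⇒≤ dQ<dP) dP≤m)) ⟩
            0# + - 0#                        ≡⟨ -‿inverseʳ 0# ⟩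
            0#                               ∎
          equation : P ⊛ v ⊕ edge-label t ≈ Q ⊛ edge-target t
          equation m = begin
            coeff (P ⊛ v ⊕ (Q ⊛ t ⊖ r)) m
              ≡⟨ coeff-⊕ (P ⊛ v) _ m ⟩
            coeff (P ⊛ v) m + coeff (Q ⊛ t ⊖ r) m
              ≡⟨ cong₂ _+_ (trans (Pv≈Qu+r m) (coeff-⊕ (Q ⊛ u) r m)) (coeff-⊖ (Q ⊛ t) r m) ⟩
            (U + R) + (T + - R)
              ≡⟨ solve 4 (λ U R T m → (U :+ R) :+ (T :+ m) := (U :+ T) :+ (R :+ m)) refl U R T (- R) ⟩
            (U + T) + (R + - R)
              ≡⟨ cancel-pair (U + T) R ⟩
            U + T
              ≡⟨ sym (⊛-distribʳ Q u t m) ⟩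
            coeff (Q ⊛ (u ⊕ t)) m
              ∎
            where
              U R T : F
              U = coeff (Q ⊛ u) m
              R = coeff r m
              T = coeff (Q ⊛ t) m

      offset-equation : ∀ s w → Edge P Q dP v s w → ∀ m → coeff (Q ⊛ (w ⊖ u)) m ≡ coeff r m + coeff s m
      offset-equation s w (_ , Pv+s≈Qw) m = begin
        coeff (Q ⊛ (w ⊖ u)) m               ≡⟨ ⊛-⊖ Q w u m ⟩
        coeff (Q ⊛ w) m + - U               ≡⟨ cong (_+ - U) (sym (Pv+s≈Qw m)) ⟩
        coeff (P ⊛ v ⊕ s) m + - U           ≡⟨ cong (_+ - U) (trans (coeff-⊕ (P ⊛ v) s m)
                                                 (cong (_+ S) (trans (Pv≈Qu+r m) (coeff-⊕ (Q ⊛ u) r m)))) ⟩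
        ((U + R) + S) + - U                 ≡⟨ solve 4 (λ U R S m → ((U :+ R) :+ S) :+ m := (R :+ S) :+ (U :+ m)) refl U R S (- U) ⟩
        (R + S) + (U + - U)                 ≡⟨ cancel-pair (R + S) U ⟩
        R + S                               ∎
        where
          U R S : F
          U = coeff (Q ⊛ u) m
          R = coeff r m
          S = coeff s m

      offset-small : ∀ s w → Edge P Q dP v s w → DegLt (w ⊖ u) n
      offset-small s w edge = DegLt-cancelˡ Q dQ hQ (w ⊖ u) n λ m dQ+n≤m → begin
        coeff (Q ⊛ (w ⊖ u)) m   ≡⟨ offset-equation s w edge m ⟩
        coeff r m + coeff s m   ≡⟨ cong₂ _+_ (r<dQ m (ℕₚ.≤-trans (ℕₚ.m≤m+n dQ n) dQ+n≤m))
                                             (proj₁ edge m (subst (_≤ m) dQ+n≡dP dQ+n≤m)) ⟩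
        0# + 0#                 ≡⟨ +-identityʳ 0# ⟩
        0#                      ∎

      offset-determines : ∀ s w → Edge P Q dP v s w → ∀ t → t ≈ w ⊖ u →
                          edge-label t ≈ s × edge-target t ≈ w
      offset-determines s w edge t t≈w-u = label-ok , target-ok
        where
          label-ok : edge-label t ≈ s
          label-ok m = begin
            coeff (Q ⊛ t ⊖ r) m                 ≡⟨ coeff-⊖ (Q ⊛ t) r m ⟩
            coeff (Q ⊛ t) m + - coeff r m       ≡⟨ cong (_+ - coeff r m)
                                                     (trans (⊛-congʳ Q t (w ⊖ u) t≈w-u m) (offset-equation s w edge m)) ⟩
            (coeff r m + coeff s m) + - coeff r m ≡⟨ xyx⁻¹≈y (coeff r m) (coeff s m) ⟩
            coeff s m                           ∎
          target-ok : edge-target t ≈ w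
          target-ok m = begin
            coeff (u ⊕ t) m                     ≡⟨ coeff-⊕ u t m ⟩
            coeff u m + coeff t m               ≡⟨ cong (coeff u m +_) (trans (t≈w-u m) (coeff-⊖ w u m)) ⟩
            coeff u m + (coeff w m + - coeff u m) ≡⟨ solve 3 (λ U W m → U :+ (W :+ m) := W :+ (U :+ m))
                                                           refl (coeff u m) (coeff w m) (- coeff u m) ⟩
            coeff w m + (coeff u m + - coeff u m) ≡⟨ cancel-pair (coeff w m) (coeff u m) ⟩
            coeff w m                           ∎

      edge-label-injective : ∀ t t′ → edge-label t ≈ edge-label t′ → t ≈ t′
      edge-label-injective t t′ same-label = ⊛-cancelˡ Q dQ hQ t t′ λ m →
        ∙-cancelʳ (- coeff r m) _ _
          (trans (sym (coeff-⊖ (Q ⊛ t) r m)) (trans (same-label m) (coeff-⊖ (Q ⊛ t′) r m)))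

      out-degree : OutDegree P Q dP v (q ^ n)
      out-degree = (λ i → edge-label (enumPoly n i)) , (λ i → edge-target (enumPoly n i))
                 , (λ i → offset-edge (enumPoly n i) (enumPoly-deg n i))
                 , (λ i j same → enumPoly-injective n i j (edge-label-injective _ _ same))
                 , complete
        where
          complete : ∀ s w → Edge P Q dP v s w →
                     ∃ λ i → edge-label (enumPoly n i) ≈ s × edge-target (enumPoly n i) ≈ w
          complete s w edge with enumPoly-surjective n (w ⊖ u) (offset-small s w edge)
          ... | i , i↦offset = i , offset-determines s w edge (enumPoly n i) i↦offset

theorem4p2 : (𝔽 : FiniteField) → let open Polynomials 𝔽 in
    (P Q : Poly) (dP dQ : ℕ) → HasDeg P dP → HasDeg Q dQ → dQ < dP → Coprime P Q →
      ((∃ λ s → Edge P Q dP 0p s 0p)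
        × ((c : Cycle P Q dP) → Cycle.k c ≡ 0 × Cycle.vertex c zero ≈ 0p × Cycle.label c zero ≈ 0p))
      × ((v : Poly) → OutDegree P Q dP v (FiniteField.q 𝔽 ^ (dP ∸ dQ)))
theorem4p2 𝔽 P Q dP dQ hP hQ dQ<dP _ =
  (zero-self-loop , cycle-is-zero-loop) , λ v → OutEdges.out-degree v
  where open Theory.ExpansionGraph 𝔽 P Q dP dQ hP hQ dQ<dP
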